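{- Consider the nucleus with $\mathsf{J}\mathbb{N}=\mathbb{N}$, $\eta(n)=n$, and $\kappa:(\mathbb{N}\to\mathbb{N})\to\mathbb{N}\to\mathbb{N}$ given by $\kappa(g,0)=g(0)$, $\kappa(g,n+1)=\max(\kappa(g,n),g(n+1))$ (definable in $\mathsf{T}$ via $\mathsf{rec}$). Then every closed term $t:\rho$ of System $\mathsf{T}$ is majorized by its $\mathsf{J}$-translation, i.e. $t \le^*_\rho t^\mathsf{J}$.
   Context: Gödel's System $\mathsf{T}$: types $\sigma,\tau ::= \mathbb{N}\mid\sigma\to\tau$; terms $x\mid\lambda x^\sigma.t\mid tu\mid 0\mid\mathsf{suc}\mid\mathsf{rec}_\sigma$ with $\mathsf{rec}_\sigma:\sigma\to(\mathbb{N}\to\sigma\to\sigma)\to\mathbb{N}\to\sigma$, $\mathsf{rec}_\sigma(a,f,0)=a$, $\mathsf{rec}_\sigma(a,f,n+1)=f(n,\mathsf{rec}_\sigma(a,f,n))$. Terms are interpreted as functionals of the corresponding finite types. $\mathsf{J}$-translation for a nucleus $(\mathsf{J}\mathbb{N},\eta,\kappa)$ (a type and terms $\eta:\mathbb{N}\to\mathsf{J}\mathbb{N}$, $\kappa:(\mathbb{N}\to\mathsf{J}\mathbb{N})\to\mathsf{J}\mathbb{N}\to\mathsf{J}\mathbb{N}$): $\mathbb{N}^\mathsf{J}:=\mathsf{J}\mathbb{N}$, $(\sigma\to\tau)^\mathsf{J}:=\sigma^\mathsf{J}\to\tau^\mathsf{J}$; $x^\mathsf{J}$ a fresh variable of type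 $\sigma^\mathsf{J}$; $(\lambda x.t)^\mathsf{J}:=\lambda x^\mathsf{J}.t^\mathsf{J}$; $(tu)^\mathsf{J}:=t^\mathsf{J}u^\mathsf{J}$; $0^\mathsf{J}:=\eta\,0$; $\mathsf{suc}^\mathsf{J}:=\kappa(\eta\circ\mathsf{suc})$; $(\mathsf{rec}_\sigma)^\mathsf{J}:=\lambda x f.\,\mathrm{ke}_\sigma(\mathsf{rec}_{\sigma^\mathsf{J}}(x,f\circ\eta))$ with $\mathrm{ke}_\mathbb{N}:=\kappa$ and $\mathrm{ke}_{\sigma\to\tau}:=\lambda g\,a\,x.\,\mathrm{ke}_\tau(\lambda n.g(n,x),a)$. (Here $\mathsf{J}\mathbb{N}=\mathbb{N}$, so $\rho^\mathsf{J}=\rho$.) Howard's majorizability relation $\le^*_\rho$ on objects of type $\rho$: $n\le^*_\mathbb{N} m$ iff $n\le m$; $f\le^*_{\sigma\to\tau} g$ iff $\forall x^\sigma y^\sigma(x\le^*_\sigma y\to fx\le^*_\tau gy)$. -}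

module Defs where

open import Data.Nat using (ℕ; zero; suc; _≤_)
open import Data.Unit using (⊤; tt)
open import Data.Product using (_×_; _,_)

infixr 5 _⇒_
data Ty : Set where
  nat : Ty
  _⇒_ : Ty → Ty → Ty

infixl 4 _▹_
data Ctx : Set where
  ∅   : Ctx
  _▹_ : Ctx → Ty → Ctx

data _∋_ : Ctx → Ty → Set where
  here  : ∀ {Γ σ} → (Γ ▹ σ) ∋ σ
  there : ∀ {Γ σ τ} → Γ ∋ σ → (Γ ▹ τ) ∋ σ

infixl 6 _·_
data Tm (Γ : Ctx) : Ty → Set where
  var  : ∀ {σ} → Γ ∋ σ → Tm Γ σ
  lam  : ∀ {σ τ} → Tm (Γ ▹ σ) τ → Tm Γ (σ ⇒ τ)
  _·_  : ∀ {σ τ} → Tm Γ (σ ⇒ τ) → Tm Γ σ → Tm Γ τ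
  zero : Tm Γ nat
  suc  : Tm Γ (nat ⇒ nat)
  rec  : (σ : Ty) → Tm Γ (σ ⇒ (nat ⇒ σ ⇒ σ) ⇒ nat ⇒ σ)

⟦_⟧ : Ty → Set
⟦ nat ⟧   = ℕ
⟦ σ ⇒ τ ⟧ = ⟦ σ ⟧ → ⟦ τ ⟧

Env : Ctx → Set
Env ∅       = ⊤
Env (Γ ▹ σ) = Env Γ × ⟦ σ ⟧

lookupEnv : ∀ {Γ σ} → Γ ∋ σ → Env Γ → ⟦ σ ⟧
lookupEnv here      (_ , a) = a
lookupEnv (there x) (ρ , _) = lookupEnv x ρ

recursor : {A : Set} → A → (ℕ → A → A) → ℕ → A
recursor a f zero    = a
recursor a f (suc n) = f n (recursor a f n)

eval : ∀ {Γ σ} → Tm Γ σ → Env Γ → ⟦ σ ⟧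
eval (var x)   ρ = lookupEnv x ρ
eval (lam t)   ρ = λ a → eval t (ρ , a)
eval (t · u)   ρ = eval t ρ (eval u ρ)
eval zero      ρ = zero
eval suc       ρ = suc
eval (rec σ)   ρ = recursor

v0 : ∀ {Γ σ} → Tm (Γ ▹ σ) σ
v0 = var here

v1 : ∀ {Γ σ τ} → Tm (Γ ▹ σ ▹ τ) σ
v1 = var (there here)

v3 : ∀ {Γ σ τ₁ τ₂ τ₃} → Tm (Γ ▹ σ ▹ τ₁ ▹ τ₂ ▹ τ₃) σ
v3 = var (there (there (there here)))

predT : ∀ {Γ} → Tm Γ (nat ⇒ nat)
predT = rec nat · zero · lam (lam v1)

addT : ∀ {Γ} → Tm Γ (nat ⇒ nat ⇒ nat)
addT = lam (lam (rec nat · v1 · lam (lam (suc · v0)) · v0))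

monusT : ∀ {Γ} → Tm Γ (nat ⇒ nat ⇒ nat)
monusT = lam (lam (rec nat · v1 · lam (lam (predT · v0)) · v0))

maxT : ∀ {Γ} → Tm Γ (nat ⇒ nat ⇒ nat)
maxT = lam (lam (addT · v1 · (monusT · v0 · v1)))

ηT : ∀ {Γ} → Tm Γ (nat ⇒ nat)
ηT = lam v0

-- κ g 0 = g 0,  κ g (n+1) = max (κ g n) (g (n+1)):
-- κ = λ g n. rec (g 0) (λ k acc. max acc (g (suc k))) n
κT : ∀ {Γ} → Tm Γ ((nat ⇒ nat) ⇒ nat ⇒ nat)
κT = lam (lam (rec nat · (v1 · zero)
                      · lam (lam (maxT · v0 · (v3 · (suc · v1))))
                      · v0))

-- ke_σ : (N → σ^J) → JN → σ^J   (here σ^J = σ since JN = N)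
ke : (σ : Ty) → ∀ {Γ} → Tm Γ ((nat ⇒ σ) ⇒ nat ⇒ σ)
ke nat       = κT
-- ke_{σ→τ} = λ g a x. ke_τ (λ n. g n x) a
ke (σ ⇒ τ)   = lam (lam (lam (ke τ · lam (var (there (there (there here))) · v0 · v1) · v1)))

-- The J-translation (ρ^J = ρ, variables translated to themselves)
J : ∀ {Γ σ} → Tm Γ σ → Tm Γ σ
J (var x)  = var x
J (lam t)  = lam (J t)
J (t · u)  = J t · J u
J zero     = ηT · zero
J suc      = κT · lam (ηT · (suc · v0))
-- rec_σ^J = λ x f. ke_σ (rec_σ x (f ∘ η))
J (rec σ)  = lam (lam (ke σ · (rec σ · v1 · lam (v1 · (ηT · v0)))))

Maj : (ρ : Ty) → ⟦ ρ ⟧ → ⟦ ρ ⟧ → Set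
Maj nat       n m = n ≤ m
Maj (σ ⇒ τ)   f g = (x y : ⟦ σ ⟧) → Maj σ x y → Maj τ (f x) (g y)

-- A logical-relations argument. Majorizability is extended pointwise to
-- environments and one shows by induction on terms that every term is majorized by its
-- J-translation under majorizing environments. Only two cases carry content. For suc,
-- κ g m is the running maximum g 0 ⊔ … ⊔ g m, so it dominates g k for every k ≤ m. For
-- rec, the recursor preserves majorization pointwise, and ke σ g m, being κ applied
-- after all arguments of type σ are supplied, majorizes anything that g k majorizes for
-- some k ≤ m; this absorbs the gap between the numeral n and its majorant n'.
module Submission where

open import Data.Unit using (⊤; tt)
open import Data.Product using (_×_; _,_)
open import Data.Sum using (inj₁; inj₂)
open import Data.Nat using (ℕ; zero; suc; pred; _+_; _∸_; _≤_; z≤n; s≤s)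
open import Data.Nat.Properties
  using (≤-refl; ≤-trans; +-identityʳ; +-suc; m≤m+n; m≤n+m∸n; m≤n⇒m<n∨m≡n; pred[m∸n]≡m∸[1+n])
open import Relation.Binary.PropositionalEquality using (_≡_; refl; sym; cong; module ≡-Reasoning)
open import Defs

-- The helper terms are closed, so their values do not depend on ρ definitionally; this is
-- what lets e.g. eval-predT be used for the predT nested under binders inside monusT.
module _ {Γ : Ctx} (ρ : Env Γ) where

  eval-predT : ∀ n → eval (predT {Γ}) ρ n ≡ pred n
  eval-predT zero    = refl
  eval-predT (suc n) = refl

  eval-addT : ∀ a b → eval (addT {Γ}) ρ a b ≡ a + b
  eval-addT a zero    = sym (+-identityʳ a)
  eval-addT a (suc b) = begin
    eval addT ρ a (suc b) ≡⟨ cong suc (eval-addT a b) ⟩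
    suc (a + b)           ≡⟨ sym (+-suc a b) ⟩
    a + suc b             ∎
    where open ≡-Reasoning

  eval-monusT : ∀ a b → eval (monusT {Γ}) ρ a b ≡ a ∸ b
  eval-monusT a zero    = refl
  eval-monusT a (suc b) = begin
    eval monusT ρ a (suc b)  ≡⟨ eval-predT (eval monusT ρ a b) ⟩
    pred (eval monusT ρ a b) ≡⟨ cong pred (eval-monusT a b) ⟩
    pred (a ∸ b)             ≡⟨ pred[m∸n]≡m∸[1+n] a b ⟩
    a ∸ suc b                ∎
    where open ≡-Reasoning

  eval-maxT : ∀ a b → eval (maxT {Γ}) ρ a b ≡ a + (b ∸ a)
  eval-maxT a b = begin
    eval maxT ρ a b       ≡⟨ eval-addT a (eval monusT ρ b a) ⟩
    a + eval monusT ρ b a ≡⟨ cong (a +_) (eval-monusT b a) ⟩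
    a + (b ∸ a)           ∎
    where open ≡-Reasoning

  maxT-upperˡ : ∀ a b → a ≤ eval (maxT {Γ}) ρ a b
  maxT-upperˡ a b rewrite eval-maxT a b = m≤m+n a (b ∸ a)

  maxT-upperʳ : ∀ a b → b ≤ eval (maxT {Γ}) ρ a b
  maxT-upperʳ a b rewrite eval-maxT a b = m≤n+m∸n b a

  κT-upper : (g : ℕ → ℕ) {k m : ℕ} → k ≤ m → g k ≤ eval (κT {Γ}) ρ g m
  κT-upper g {m = zero}  z≤n = ≤-refl
  κT-upper g {m = suc m} k≤1+m with m≤n⇒m<n∨m≡n k≤1+m
  ... | inj₂ refl      = maxT-upperʳ (eval κT ρ g m) (g (suc m))
  ... | inj₁ (s≤s k≤m) = ≤-trans (κT-upper g k≤m) (maxT-upperˡ (eval κT ρ g m) (g (suc m)))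

ke-majorizes : (σ : Ty) {Γ : Ctx} (ρ : Env Γ) (g : ℕ → ⟦ σ ⟧) (x : ⟦ σ ⟧) {k m : ℕ} →
               k ≤ m → Maj σ x (g k) → Maj σ x (eval (ke σ {Γ}) ρ g m)
ke-majorizes nat     ρ g x k≤m x≤gk = ≤-trans x≤gk (κT-upper ρ g k≤m)
ke-majorizes (σ ⇒ τ) ρ g x {m = m} k≤m x≤*gk y z y≤*z =
  ke-majorizes τ (((ρ , g) , m) , z) (λ n → g n z) (x y) k≤m (x≤*gk y z y≤*z)

recursor-majorizes : (σ : Ty) {a a' : ⟦ σ ⟧} {f f' : ℕ → ⟦ σ ⟧ → ⟦ σ ⟧} →
                     Maj σ a a' → Maj (nat ⇒ σ ⇒ σ) f f' →
                     (n : ℕ) → Maj σ (recursor a f n) (recursor a' f' n)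
recursor-majorizes σ a≤*a' f≤*f' zero    = a≤*a'
recursor-majorizes σ a≤*a' f≤*f' (suc n) =
  f≤*f' n n ≤-refl _ _ (recursor-majorizes σ a≤*a' f≤*f' n)

MajEnv : (Γ : Ctx) → Env Γ → Env Γ → Set
MajEnv ∅       _       _         = ⊤
MajEnv (Γ ▹ σ) (ρ , a) (ρ' , a') = MajEnv Γ ρ ρ' × Maj σ a a'

lookupEnv-majorizes : ∀ {Γ σ} (x : Γ ∋ σ) {ρ ρ' : Env Γ} →
                      MajEnv Γ ρ ρ' → Maj σ (lookupEnv x ρ) (lookupEnv x ρ')
lookupEnv-majorizes here      (_ , a≤*a') = a≤*a'
lookupEnv-majorizes (there x) (ρ≤*ρ' , _) = lookupEnv-majorizes x ρ≤*ρ'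

J-majorizes : ∀ {Γ σ} (t : Tm Γ σ) {ρ ρ' : Env Γ} →
              MajEnv Γ ρ ρ' → Maj σ (eval t ρ) (eval (J t) ρ')
J-majorizes (var x) ρ≤*ρ' = lookupEnv-majorizes x ρ≤*ρ'
J-majorizes (lam t) ρ≤*ρ' x y x≤*y = J-majorizes t (ρ≤*ρ' , x≤*y)
J-majorizes (t · u) ρ≤*ρ' = J-majorizes t ρ≤*ρ' _ _ (J-majorizes u ρ≤*ρ')
J-majorizes zero    ρ≤*ρ' = z≤n
J-majorizes suc {ρ' = ρ'} _ x y x≤y = ≤-trans (s≤s x≤y) (κT-upper ρ' suc {k = y} ≤-refl)
J-majorizes (rec σ) {ρ' = ρ'} _ a a' a≤*a' f f' f≤*f' n n' n≤n' =
  ke-majorizes σ ((ρ' , a') , f') (recursor a' f') (recursor a f n) n≤n'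
    (recursor-majorizes σ a≤*a' f≤*f' n)

corollary6 : {ρ : Ty} (t : Tm ∅ ρ) → Maj ρ (eval t tt) (eval (J t) tt)
corollary6 t = J-majorizes t tt
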